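{- For all positive integers $n$ and $k$, $$\omega\Big(2^{(2^{3^n}+1)^k}+1\Big)\ge (k+1)^n-1\ge k^n.$$
   Context: $\omega(m)$ denotes the number of distinct prime factors of $m$. -}

module Defs where

open import Data.Nat using (ℕ; suc)
open import Data.Nat.Divisibility using (_∣?_)
open import Data.Nat.Primality using (prime?)
open import Data.List using (List; filter; upTo; length)
open import Relation.Nullary.Decidable using (_×-dec_)

-- The list of distinct primes dividing m (for m ≥ 1 every prime divisor is ≤ m,
-- so scanning 0 … m finds all of them, each exactly once).
primeDivisors : ℕ → List ℕ
primeDivisors m = filter (λ p → prime? p ×-dec (p ∣? m)) (upTo (suc m))

ω : ℕ → ℕ
ω m = length (primeDivisors m)

-- Write F d = 2^d + 1 and N = F (3^n). For every d = 3^(a+2) ρ₀^e₀ ⋯ ρ_(n−2)^e_(n−2) with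
-- a + 2 ≤ (n + 1) k and eᵢ ≤ k, where ρᵢ is a prime dividing F (3^(i+2)) but not F (3^(i+1)),
-- d divides N^k and N^k / d is odd, so F d divides F (N^k). Each such F d has a primitive
-- prime divisor q, one dividing no F e for a proper divisor e of d: with K = ∏_{p ∣ d} p F (d / p),
-- the quotient F d / gcd (F d, K) exceeds 1 because K < F d (the ρᵢ grow fast: 2 · 3^(i+2) < ρᵢ),
-- and by lifting the exponent none of its prime factors divides any F (d / p). Primitive divisors
-- of different d differ, giving ((n + 1) k − 1)(k + 1)^(n−1) ≥ (k + 1)^n − 1 primes of F (N^k).
module Submission where

open import Data.Nat.Base as ℕ using (ℕ; zero; suc)
import Data.Nat.Properties as ℕ
open import Data.Nat.Combinatorics using (_C_; nC1≡n; nCk+nC[k+1]≡[n+1]C[k+1])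
open import Data.Fin using (Fin; toℕ; fromℕ<)
open import Data.Fin.Properties using (pigeonhole; toℕ<n; toℕ-fromℕ<)
open import Data.List using (List; []; _∷_; map; length; upTo; cartesianProductWith; cartesianProduct; _++_)
open import Data.List.Properties using (length-map; length-++; length-upTo)
open import Data.List.Membership.Propositional using (_∈_)
open import Data.List.Membership.Propositional.Properties
  using (∈-map⁺; ∈-map⁻; ∈-cartesianProductWith⁻; ∈-cartesianProduct⁻; ∈-upTo⁺; ∈-upTo⁻; ∈-∃++; ∈-++⁻; ∈-++⁺ˡ; ∈-++⁺ʳ; ∈-filter⁺)
open import Data.List.Relation.Unary.All as All using (All; []; _∷_)
open import Data.List.Relation.Unary.All.Properties using (map⁺)
open import Data.List.Relation.Unary.Any using (here; there)
open import Data.List.Relation.Unary.Unique.Propositional using (Unique; []; _∷_)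
open import Data.List.Relation.Unary.Unique.Propositional.Properties using (cartesianProductWith⁺; cartesianProduct⁺; upTo⁺)
open import Data.Product using (∃; ∃₂; Σ; _×_; _,_; proj₁; proj₂)
open import Data.Sum using (inj₁; inj₂; [_,_]′)
open import Data.Empty using (⊥-elim)
open import Function using (_∘_; id)
open import Relation.Nullary using (¬_; yes; no)
open import Relation.Nullary.Decidable using (toWitness; _×-dec_)
open import Relation.Binary.PropositionalEquality
  using (_≡_; _≢_; refl; sym; trans; cong; cong₂; subst; module ≡-Reasoning)

open import Defs

-- Placed before the operators of ℕ are opened, so that those of ℤ can be used unqualified.
module AlternatingSum where

  open import Data.Integer
    using (ℤ; +_; -[1+_]; 0ℤ; 1ℤ; _+_; _-_; _*_; -_; _^_)
  open import Data.Integer.Properties using (pos-+; pos-*; *-cancelˡ-≡; +-injective)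
  open import Data.Integer.Solver using (module +-*-Solver)
  open +-*-Solver
  open ≡-Reasoning

  suc[t]C2≡tC2+t : ∀ t → suc t C 2 ≡ t C 2 ℕ.+ t
  suc[t]C2≡tC2+t t = begin
    suc t C 2       ≡⟨ sym (nCk+nC[k+1]≡[n+1]C[k+1] t 1) ⟩
    t C 1 ℕ.+ t C 2 ≡⟨ cong (ℕ._+ t C 2) (nC1≡n t) ⟩
    t ℕ.+ t C 2     ≡⟨ ℕ.+-comm t (t C 2) ⟩
    t C 2 ℕ.+ t     ∎

  pos-^ : ∀ m n → + (m ℕ.^ n) ≡ (+ m) ^ n
  pos-^ m zero = refl
  pos-^ m (suc n) = trans (pos-* m (m ℕ.^ n)) (cong (+ m *_) (pos-^ m n))

  -- alternating x t = Σ_{i<t} (−x)^i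
  alternating : ℤ → ℕ → ℤ
  alternating x zero = 0ℤ
  alternating x (suc t) = 1ℤ - x * alternating x t

  -- With y = x + 1 we have −x = 1 − y; expand (1 − y)^i binomially modulo y² and sum over i < t.
  alternating-mod-square : ∀ x t → ∃ λ w →
    alternating x t ≡ + t - (x + 1ℤ) * + (t C 2) + (x + 1ℤ) * (x + 1ℤ) * w
  alternating-mod-square x zero = 0ℤ ,
    solve 1 (λ x → con 0ℤ := con 0ℤ :- (x :+ con 1ℤ) :* con 0ℤ :+ (x :+ con 1ℤ) :* (x :+ con 1ℤ) :* con 0ℤ) refl x
  alternating-mod-square x (suc t) with alternating-mod-square x t
  ... | w , eq = w + + (t C 2) - (x + 1ℤ) * w , (begin
    1ℤ - x * alternating x t
      ≡⟨ cong (λ a → 1ℤ - x * a) eq ⟩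
    1ℤ - x * (+ t - (x + 1ℤ) * + (t C 2) + (x + 1ℤ) * (x + 1ℤ) * w)
      ≡⟨ solve 4 (λ x t c w → con 1ℤ :- x :* (t :- (x :+ con 1ℤ) :* c :+ (x :+ con 1ℤ) :* (x :+ con 1ℤ) :* w)
              := (con 1ℤ :+ t) :- (x :+ con 1ℤ) :* (c :+ t) :+ (x :+ con 1ℤ) :* (x :+ con 1ℤ) :* (w :+ c :- (x :+ con 1ℤ) :* w))
              refl x (+ t) (+ (t C 2)) w ⟩
    (1ℤ + + t) - (x + 1ℤ) * (+ (t C 2) + + t) + (x + 1ℤ) * (x + 1ℤ) * (w + + (t C 2) - (x + 1ℤ) * w)
      ≡⟨ cong₂ (λ a b → a - (x + 1ℤ) * b + (x + 1ℤ) * (x + 1ℤ) * (w + + (t C 2) - (x + 1ℤ) * w))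
               (sym (pos-+ 1 t)) (trans (sym (pos-+ (t C 2) t)) (cong +_ (sym (suc[t]C2≡tC2+t t)))) ⟩
    + suc t - (x + 1ℤ) * + (suc t C 2) + (x + 1ℤ) * (x + 1ℤ) * (w + + (t C 2) - (x + 1ℤ) * w) ∎)

  *-alternating-odd : ∀ x h → (x + 1ℤ) * alternating x (suc (2 ℕ.* h)) ≡ 1ℤ + x ^ suc (2 ℕ.* h)
  *-alternating-odd x zero =
    solve 1 (λ x → (x :+ con 1ℤ) :* (con 1ℤ :- x :* con 0ℤ) := con 1ℤ :+ x :* con 1ℤ) refl x
  *-alternating-odd x (suc h) = begin
    (x + 1ℤ) * alternating x (suc (2 ℕ.* suc h))
      ≡⟨ cong (λ n → (x + 1ℤ) * alternating x (suc n)) (ℕ.*-suc 2 h) ⟩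
    (x + 1ℤ) * (1ℤ - x * (1ℤ - x * a))
      ≡⟨ solve 2 (λ x a → (x :+ con 1ℤ) :* (con 1ℤ :- x :* (con 1ℤ :- x :* a))
                        := con 1ℤ :- x :* x :+ x :* x :* ((x :+ con 1ℤ) :* a)) refl x a ⟩
    1ℤ - x * x + x * x * ((x + 1ℤ) * a)
      ≡⟨ cong (λ b → 1ℤ - x * x + x * x * b) (*-alternating-odd x h) ⟩
    1ℤ - x * x + x * x * (1ℤ + x ^ suc (2 ℕ.* h))
      ≡⟨ solve 2 (λ x b → con 1ℤ :- x :* x :+ x :* x :* (con 1ℤ :+ b) := con 1ℤ :+ x :* (x :* b)) refl x (x ^ suc (2 ℕ.* h)) ⟩
    1ℤ + x ^ suc (suc (suc (2 ℕ.* h)))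
      ≡⟨ cong (λ n → 1ℤ + x ^ suc n) (sym (ℕ.*-suc 2 h)) ⟩
    1ℤ + x ^ suc (2 ℕ.* suc h) ∎
    where a = alternating x (suc (2 ℕ.* h))

  private
    pos-+-*² : ∀ a b d → + (a ℕ.+ b ℕ.* b ℕ.* d) ≡ + a + + b * + b * + d
    pos-+-*² a b d = begin
      + (a ℕ.+ b ℕ.* b ℕ.* d)   ≡⟨ pos-+ a (b ℕ.* b ℕ.* d) ⟩
      + a + + (b ℕ.* b ℕ.* d)   ≡⟨ cong (λ z → + a + z) (pos-* (b ℕ.* b) d) ⟩
      + a + + (b ℕ.* b) * + d   ≡⟨ cong (λ z → + a + z * + d) (pos-* b b) ⟩
      + a + + b * + b * + d     ∎

    pos-+-*-*² : ∀ a b c d → + (a ℕ.+ b ℕ.* c ℕ.+ b ℕ.* b ℕ.* d) ≡ + a + + b * + c + + b * + b * + d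
    pos-+-*-*² a b c d = begin
      + (a ℕ.+ b ℕ.* c ℕ.+ b ℕ.* b ℕ.* d) ≡⟨ pos-+-*² (a ℕ.+ b ℕ.* c) b d ⟩
      + (a ℕ.+ b ℕ.* c) + + b * + b * + d ≡⟨ cong (λ z → z + + b * + b * + d) (pos-+ a (b ℕ.* c)) ⟩
      + a + + (b ℕ.* c) + + b * + b * + d ≡⟨ cong (λ z → + a + z + + b * + b * + d) (pos-* b c) ⟩
      + a + + b * + c + + b * + b * + d   ∎

  quotient-congruence : ∀ X h S → let p = suc (2 ℕ.* h); y = X ℕ.+ 1 in
    y ℕ.* S ≡ X ℕ.^ p ℕ.+ 1 →
    ∃₂ λ V₁ V₂ → S ℕ.+ y ℕ.* (p C 2) ℕ.+ y ℕ.* y ℕ.* V₁ ≡ p ℕ.+ y ℕ.* y ℕ.* V₂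
  quotient-congruence X h S eq = result w congruence
    where
    p = suc (2 ℕ.* h)
    w = proj₁ (alternating-mod-square (+ X) p)
    expansion = proj₂ (alternating-mod-square (+ X) p)
    y = X ℕ.+ 1
    c = p C 2
    y≡X+1 : + y ≡ + X + 1ℤ
    y≡X+1 = pos-+ X 1
    y≢0 : ℕ.NonZero y
    y≢0 = subst ℕ.NonZero (ℕ.+-comm 1 X) _
    S≡alternating : + S ≡ alternating (+ X) p
    S≡alternating = *-cancelˡ-≡ (+ y) (+ S) (alternating (+ X) p) {{y≢0}} (begin
      + y * + S                     ≡⟨ pos-* y S ⟨
      + (y ℕ.* S)                   ≡⟨ cong +_ (trans eq (ℕ.+-comm (X ℕ.^ p) 1)) ⟩
      + (1 ℕ.+ X ℕ.^ p)             ≡⟨ pos-+ 1 (X ℕ.^ p) ⟩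
      1ℤ + + (X ℕ.^ p)              ≡⟨ cong (λ z → 1ℤ + z) (pos-^ X p) ⟩
      1ℤ + (+ X) ^ p                ≡⟨ *-alternating-odd (+ X) h ⟨
      (+ X + 1ℤ) * alternating (+ X) p ≡⟨ cong (_* alternating (+ X) p) y≡X+1 ⟨
      + y * alternating (+ X) p     ∎)
    congruence : + S + + y * + c ≡ + p + + y * + y * w
    congruence = begin
      + S + + y * + c
        ≡⟨ cong (λ s → s + + y * + c) (trans S≡alternating expansion) ⟩
      + p - (+ X + 1ℤ) * + c + (+ X + 1ℤ) * (+ X + 1ℤ) * w + + y * + c
        ≡⟨ cong (λ z → + p - z * + c + z * z * w + + y * + c) y≡X+1 ⟨
      + p - + y * + c + + y * + y * w + + y * + c
        ≡⟨ solve 4 (λ p y c w → p :- y :* c :+ y :* y :* w :+ y :* c := p :+ y :* y :* w) refl (+ p) (+ y) (+ c) w ⟩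
      + p + + y * + y * w ∎
    result : ∀ w → + S + + y * + c ≡ + p + + y * + y * w →
      ∃₂ λ V₁ V₂ → S ℕ.+ y ℕ.* c ℕ.+ y ℕ.* y ℕ.* V₁ ≡ p ℕ.+ y ℕ.* y ℕ.* V₂
    result (+ v) e = 0 , v , +-injective (begin
      + (S ℕ.+ y ℕ.* c ℕ.+ y ℕ.* y ℕ.* 0)   ≡⟨ pos-+-*-*² S y c 0 ⟩
      + S + + y * + c + + y * + y * 0ℤ      ≡⟨ solve 3 (λ s y c → s :+ y :* c :+ y :* y :* con 0ℤ := s :+ y :* c) refl (+ S) (+ y) (+ c) ⟩
      + S + + y * + c                       ≡⟨ e ⟩
      + p + + y * + y * + v                 ≡⟨ pos-+-*² p y v ⟨
      + (p ℕ.+ y ℕ.* y ℕ.* v)               ∎)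
    result -[1+ v ] e = suc v , 0 , +-injective (begin
      + (S ℕ.+ y ℕ.* c ℕ.+ y ℕ.* y ℕ.* suc v)    ≡⟨ pos-+-*-*² S y c (suc v) ⟩
      + S + + y * + c + + y * + y * + suc v      ≡⟨ cong (λ z → z + + y * + y * + suc v) e ⟩
      + p + + y * + y * -[1+ v ] + + y * + y * + suc v
        ≡⟨ solve 3 (λ p y v → p :+ y :* y :* (:- v) :+ y :* y :* v := p :+ y :* y :* con 0ℤ) refl (+ p) (+ y) (+ suc v) ⟩
      + p + + y * + y * 0ℤ                       ≡⟨ pos-+-*² p y 0 ⟨
      + (p ℕ.+ y ℕ.* y ℕ.* 0)                    ∎)

open AlternatingSum using (suc[t]C2≡tC2+t; quotient-congruence)

open import Data.Nat
open import Data.Nat.Properties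
open import Data.Nat.Divisibility
open import Data.Nat.DivMod using (_%_; _/_; m%n<n; m≡m%n+[m/n]*n)
open import Data.Nat.GCD
open import Data.Nat.Coprimality using (Coprime; coprime-divisor)
open import Data.Nat.Primality
open import Data.Nat.Primality.Factorisation using (factorise)
open import Data.Nat.ListAction using (product; sum)
open import Data.Nat.ListAction.Properties using (∈⇒∣product; product≢0)
open import Data.Nat.Solver using (module +-*-Solver)
open +-*-Solver

prime⇒≥2 : ∀ {p} → Prime p → 2 ≤ p
prime⇒≥2 {suc (suc _)} _ = s≤s (s≤s z≤n)

prime∣prime⇒≡ : ∀ {p r} → Prime p → Prime r → r ∣ p → r ≡ p
prime∣prime⇒≡ p-prime r-prime r∣p with prime⇒irreducible p-prime r∣p
... | inj₂ r≡p = r≡p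
... | inj₁ refl with prime⇒≥2 r-prime
... | s≤s ()

prime∣^⇒∣ : ∀ {p m} n → Prime p → p ∣ m ^ n → p ∣ m
prime∣^⇒∣ zero p-prime p∣1 with prime⇒≥2 p-prime | ∣1⇒≡1 p∣1
... | s≤s (s≤s _) | ()
prime∣^⇒∣ {m = m} (suc n) p-prime p∣m^n with euclidsLemma m (m ^ n) p-prime p∣m^n
... | inj₁ p∣m = p∣m
... | inj₂ p∣m^n = prime∣^⇒∣ n p-prime p∣m^n

∃prime∣ : ∀ {n} → 2 ≤ n → ∃ λ q → Prime q × q ∣ n
∃prime∣ {1} (s≤s ())
∃prime∣ {n@(suc (suc _))} _ with factorise n
... | record { factors = q ∷ qs ; isFactorisation = n≡∏ ; factorsPrime = q-prime ∷ _ } =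
  q , q-prime , subst (q ∣_) (sym n≡∏) (m∣m*n (product qs))

odd⇒≡1+2* : ∀ {n} → ¬ 2 ∣ n → ∃ λ s → n ≡ suc (2 * s)
odd⇒≡1+2* {zero} 2∤0 = ⊥-elim (2∤0 (divides 0 refl))
odd⇒≡1+2* {suc zero} _ = 0 , refl
odd⇒≡1+2* {suc (suc n)} 2∤n+2 with odd⇒≡1+2* (λ 2∣n → 2∤n+2 (∣m∣n⇒∣m+n (∣-refl {2}) 2∣n))
... | s , refl = suc s , cong suc (sym (*-suc 2 s))

prime[3] : Prime 3
prime[3] = toWitness {a? = prime? 3} _

2∤3 : ¬ 2 ∣ 3
2∤3 2∣3 with ∣1⇒≡1 (∣m+n∣m⇒∣n {2} {2} {1} 2∣3 ∣-refl)
... | ()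

odd⇒≥1 : ∀ {n} → ¬ 2 ∣ n → 1 ≤ n
odd⇒≥1 2∤n with odd⇒≡1+2* 2∤n
... | _ , refl = s≤s z≤n

2∤3^ : ∀ k → ¬ 2 ∣ 3 ^ k
2∤3^ k 2∣3^k = 2∤3 (prime∣^⇒∣ k prime[2] 2∣3^k)

^-monoˡ-∣ : ∀ {a b} k → a ∣ b → a ^ k ∣ b ^ k
^-monoˡ-∣ zero _ = ∣-refl
^-monoˡ-∣ (suc k) a∣b = *-pres-∣ a∣b (^-monoˡ-∣ k a∣b)

^-monoʳ-∣ : ∀ x {e k} → e ≤ k → x ^ e ∣ x ^ k
^-monoʳ-∣ x {e} {k} e≤k = divides (x ^ (k ∸ e)) (begin
  x ^ k                 ≡⟨ cong (x ^_) (m+[n∸m]≡n e≤k) ⟨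
  x ^ (e + (k ∸ e))     ≡⟨ ^-distribˡ-+-* x e (k ∸ e) ⟩
  x ^ e * x ^ (k ∸ e)   ≡⟨ *-comm (x ^ e) _ ⟩
  x ^ (k ∸ e) * x ^ e   ∎)
  where open ≡-Reasoning

m+1∣m^[1+2s]+1 : ∀ m s → m + 1 ∣ m ^ suc (2 * s) + 1
m+1∣m^[1+2s]+1 m zero = subst (λ z → m + 1 ∣ z + 1) (sym (*-identityʳ m)) ∣-refl
m+1∣m^[1+2s]+1 zero (suc s) = divides 1 refl
m+1∣m^[1+2s]+1 m@(suc l) (suc s) = ∣m+n∣m⇒∣n (subst (m + 1 ∣_) split (∣n⇒∣m*n (m * m) (m+1∣m^[1+2s]+1 m s))) (n∣m*n l)
  where
  split : m * m * (m ^ suc (2 * s) + 1) ≡ l * (m + 1) + (m ^ suc (2 * suc s) + 1)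
  split = begin
    m * m * (P + 1)                     ≡⟨ solve 2 (λ l P → (con 1 :+ l) :* (con 1 :+ l) :* (P :+ con 1)
                                                  := l :* ((con 1 :+ l) :+ con 1) :+ ((con 1 :+ l) :* ((con 1 :+ l) :* P) :+ con 1)) refl l P ⟩
    l * (m + 1) + (m * (m * P) + 1)     ≡⟨ cong (λ e → l * (m + 1) + (m ^ suc e + 1)) (*-suc 2 s) ⟨
    l * (m + 1) + (m ^ suc (2 * suc s) + 1) ∎
    where
    open ≡-Reasoning
    P = m ^ suc (2 * s)

-- Numbers of the form 2^a ± 1

F : ℕ → ℕ
F x = 2 ^ x + 1

M : ℕ → ℕ
M a = pred (2 ^ a)

F≢0 : ∀ a → NonZero (F a)
F≢0 a = subst NonZero (+-comm 1 (2 ^ a)) _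

2^≡1+M : ∀ a → 2 ^ a ≡ suc (M a)
2^≡1+M a = sym (suc-pred (2 ^ a) {{m^n≢0 2 a}})

F≡M+2 : ∀ a → F a ≡ M a + 2
F≡M+2 a = trans (cong (_+ 1) (2^≡1+M a)) (sym (+-suc (M a) 1))

1+M[a+b]≡[1+M]*[1+M] : ∀ a b → suc (M (a + b)) ≡ suc (M a) * suc (M b)
1+M[a+b]≡[1+M]*[1+M] a b = begin
  suc (M (a + b))       ≡⟨ 2^≡1+M (a + b) ⟨
  2 ^ (a + b)           ≡⟨ ^-distribˡ-+-* 2 a b ⟩
  2 ^ a * 2 ^ b         ≡⟨ cong₂ _*_ (2^≡1+M a) (2^≡1+M b) ⟩
  suc (M a) * suc (M b) ∎
  where open ≡-Reasoning

M[2a]≡M*F : ∀ a → M (2 * a) ≡ M a * F a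
M[2a]≡M*F a = suc-injective (begin
  suc (M (2 * a))       ≡⟨ cong (λ b → suc (M (a + b))) (+-identityʳ a) ⟩
  suc (M (a + a))       ≡⟨ 1+M[a+b]≡[1+M]*[1+M] a a ⟩
  suc (M a) * suc (M a) ≡⟨ solve 1 (λ x → (con 1 :+ x) :* (con 1 :+ x) := con 1 :+ x :* (x :+ con 2)) refl (M a) ⟩
  suc (M a * (M a + 2)) ≡⟨ cong (λ f → suc (M a * f)) (F≡M+2 a) ⟨
  suc (M a * F a)       ∎)
  where open ≡-Reasoning

[1+y]^t≡1+c*y : ∀ y t → ∃ λ c → suc y ^ t ≡ suc (c * y)
[1+y]^t≡1+c*y y zero = 0 , refl
[1+y]^t≡1+c*y y (suc t) with [1+y]^t≡1+c*y y t
... | c , eq = c + suc (c * y) , (begin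
  suc y * suc y ^ t   ≡⟨ cong (suc y *_) eq ⟩
  suc y * suc (c * y) ≡⟨ solve 2 (λ y c → (con 1 :+ y) :* (con 1 :+ c :* y) := con 1 :+ (c :+ (con 1 :+ c :* y)) :* y) refl y c ⟩
  suc ((c + suc (c * y)) * y) ∎)
  where open ≡-Reasoning

M∣M[a*t] : ∀ a t → M a ∣ M (a * t)
M∣M[a*t] a t with [1+y]^t≡1+c*y (M a) t
... | c , eq = divides c (suc-injective (begin
  suc (M (a * t))  ≡⟨ 2^≡1+M (a * t) ⟨
  2 ^ (a * t)      ≡⟨ ^-*-assoc 2 a t ⟨
  (2 ^ a) ^ t      ≡⟨ cong (_^ t) (2^≡1+M a) ⟩
  suc (M a) ^ t    ≡⟨ eq ⟩
  suc (c * M a)    ∎))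
  where open ≡-Reasoning

M-mono-∣ : ∀ {g a} → g ∣ a → M g ∣ M a
M-mono-∣ {g} (divides t refl) = subst (λ a → M g ∣ M a) (*-comm g t) (M∣M[a*t] g t)

∣M[g+u]∧∣M[u]⇒∣M[g] : ∀ {q} g u → q ∣ M (g + u) → q ∣ M u → q ∣ M g
∣M[g+u]∧∣M[u]⇒∣M[g] {q} g u q∣M[g+u] q∣M[u] =
  ∣m+n∣m⇒∣n (subst (q ∣_) split q∣M[g+u]) (∣n⇒∣m*n (suc (M g)) q∣M[u])
  where
  split : M (g + u) ≡ suc (M g) * M u + M g
  split = suc-injective (trans (1+M[a+b]≡[1+M]*[1+M] g u)
    (solve 2 (λ x y → (con 1 :+ x) :* (con 1 :+ y) := con 1 :+ ((con 1 :+ x) :* y :+ x)) refl (M g) (M u)))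

∣M∧∣M⇒∣M[gcd] : ∀ {q} a b → q ∣ M a → q ∣ M b → q ∣ M (gcd a b)
∣M∧∣M⇒∣M[gcd] {q} a b q∣M[a] q∣M[b] with Bézout.identity (gcd-GCD a b)
... | Bézout.+- x y gcd+yb≡xa = ∣M[g+u]∧∣M[u]⇒∣M[g] (gcd a b) (y * b)
  (subst (λ z → q ∣ M z) (trans (*-comm a x) (sym gcd+yb≡xa)) (∣-trans q∣M[a] (M∣M[a*t] a x)))
  (subst (λ z → q ∣ M z) (*-comm b y) (∣-trans q∣M[b] (M∣M[a*t] b y)))
... | Bézout.-+ x y gcd+xa≡yb = ∣M[g+u]∧∣M[u]⇒∣M[g] (gcd a b) (x * a)
  (subst (λ z → q ∣ M z) (trans (*-comm b y) (sym gcd+xa≡yb)) (∣-trans q∣M[b] (M∣M[a*t] b y)))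
  (subst (λ z → q ∣ M z) (*-comm a x) (∣-trans q∣M[a] (M∣M[a*t] a x)))

2∤F : ∀ {a} → 1 ≤ a → ¬ 2 ∣ F a
2∤F {suc a} _ 2∣F with ∣1⇒≡1 (∣m+n∣m⇒∣n 2∣F (m∣m*n {2} (2 ^ a)))
... | ()

F∣F[c*odd] : ∀ c {w} → ¬ 2 ∣ w → F c ∣ F (c * w)
F∣F[c*odd] c 2∤w with odd⇒≡1+2* 2∤w
... | s , refl = subst (λ z → F c ∣ z + 1) (^-*-assoc 2 c (suc (2 * s))) (m+1∣m^[1+2s]+1 (2 ^ c) s)

F-mono-∣ : ∀ {e c} → e ∣ c → ¬ 2 ∣ c → F e ∣ F c
F-mono-∣ {e} (divides w refl) 2∤c =
  subst (λ z → F e ∣ F z) (*-comm e w) (F∣F[c*odd] e (λ 2∣w → 2∤c (∣m⇒∣m*n e 2∣w)))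

-- Since F a ∣ M (2 a), a common divisor of F a and F b divides M (2 gcd a b) = M (gcd a b) F (gcd a b);
-- it cannot divide M (gcd a b) as well, for then it would divide F a − M a = 2.
prime∣F∧∣F⇒∣F[gcd] : ∀ {q} a b → Prime q → 1 ≤ a → q ∣ F a → q ∣ F b → q ∣ F (gcd a b)
prime∣F∧∣F⇒∣F[gcd] {q} a b q-prime 1≤a q∣F[a] q∣F[b] =
  [ (λ q∣M[g] → ⊥-elim (2∤F 1≤a (subst (_∣ F a) (q∣M[g]⇒q≡2 q∣M[g]) q∣F[a]))) , id ]′
  (euclidsLemma (M g) (F g) q-prime q∣M[g]*F[g])
  where
  g = gcd a b
  q∣M[2c] : ∀ c → q ∣ F c → q ∣ M (2 * c)
  q∣M[2c] c q∣F[c] = subst (q ∣_) (sym (M[2a]≡M*F c)) (∣n⇒∣m*n (M c) q∣F[c])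
  q∣M[g]*F[g] : q ∣ M g * F g
  q∣M[g]*F[g] = subst (q ∣_) (trans (cong M (sym (c*gcd[m,n]≡gcd[cm,cn] 2 a b))) (M[2a]≡M*F g))
    (∣M∧∣M⇒∣M[gcd] (2 * a) (2 * b) (q∣M[2c] a q∣F[a]) (q∣M[2c] b q∣F[b]))
  q∣M[g]⇒q≡2 : q ∣ M g → q ≡ 2
  q∣M[g]⇒q≡2 q∣M[g] = prime∣prime⇒≡ prime[2] q-prime
    (∣m+n∣m⇒∣n (subst (q ∣_) (F≡M+2 a) q∣F[a]) (∣-trans q∣M[g] (M-mono-∣ (gcd[m,n]∣m a b))))

[1+2h]C2≡[1+2h]*h : ∀ h → suc (2 * h) C 2 ≡ suc (2 * h) * h
[1+2h]C2≡[1+2h]*h zero = refl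
[1+2h]C2≡[1+2h]*h (suc h) = begin
  suc (2 * suc h) C 2                                    ≡⟨ cong (λ n → suc n C 2) (*-suc 2 h) ⟩
  suc (suc p) C 2                                        ≡⟨ suc[t]C2≡tC2+t (suc p) ⟩
  suc p C 2 + suc p                                      ≡⟨ cong (_+ suc p) (suc[t]C2≡tC2+t p) ⟩
  p C 2 + p + suc p                                      ≡⟨ cong (λ c → c + p + suc p) ([1+2h]C2≡[1+2h]*h h) ⟩
  p * h + p + suc p                                      ≡⟨ solve 1 (λ h → (con 1 :+ con 2 :* h) :* h :+ (con 1 :+ con 2 :* h) :+ (con 2 :+ con 2 :* h)
                                                                    := (con 1 :+ con 2 :* (con 1 :+ h)) :* (con 1 :+ h)) refl h ⟩
  suc (2 * suc h) * suc h                                ∎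
  where
  open ≡-Reasoning
  p = suc (2 * h)

-- Lifting the exponent for p = 2h + 1: S = (X^p + 1) / (X + 1) ≡ p − (X + 1) · C(p, 2) modulo
-- (X + 1)², and p divides C(p, 2).
module OddPowerQuotient (X h : ℕ) where

  p : ℕ
  p = suc (2 * h)

  S : ℕ
  S = quotient (m+1∣m^[1+2s]+1 X h)

  [X+1]*S≡X^p+1 : (X + 1) * S ≡ X ^ p + 1
  [X+1]*S≡X^p+1 = sym (m∣n⇒n≡m*quotient (m+1∣m^[1+2s]+1 X h))

  private
    y = X + 1
    congruence = quotient-congruence X h S [X+1]*S≡X^p+1
    V₁ = proj₁ congruence
    V₂ = proj₁ (proj₂ congruence)
    p∣C2 : p ∣ p C 2
    p∣C2 = divides h (trans ([1+2h]C2≡[1+2h]*h h) (*-comm p h))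
    S+y*c+y²V₁≡p+y²V₂ : S + y * (p C 2) + y * y * V₁ ≡ p + y * y * V₂
    S+y*c+y²V₁≡p+y²V₂ = proj₂ (proj₂ congruence)

  ∣S∧∣X+1⇒∣p : ∀ {q} → q ∣ S → q ∣ X + 1 → q ∣ p
  ∣S∧∣X+1⇒∣p {q} q∣S q∣y = ∣m+n∣m⇒∣n
    (subst (q ∣_) (trans S+y*c+y²V₁≡p+y²V₂ (+-comm p _))
      (∣m∣n⇒∣m+n (∣m∣n⇒∣m+n q∣S (∣m⇒∣m*n _ q∣y)) (∣m⇒∣m*n V₁ (∣m⇒∣m*n y q∣y))))
    (∣m⇒∣m*n V₂ (∣m⇒∣m*n y q∣y))

  p∣X+1⇒p∣S : p ∣ X + 1 → p ∣ S
  p∣X+1⇒p∣S p∣y = ∣m+n∣m⇒∣n (subst (p ∣_) (+-comm S _) p∣S+yc) (∣m⇒∣m*n _ p∣y)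
    where
    p∣S+yc+y²V₁ : p ∣ S + y * (p C 2) + y * y * V₁
    p∣S+yc+y²V₁ = subst (p ∣_) (sym S+y*c+y²V₁≡p+y²V₂) (∣m∣n⇒∣m+n ∣-refl (∣m⇒∣m*n V₂ (∣m⇒∣m*n y p∣y)))
    p∣S+yc : p ∣ S + y * (p C 2)
    p∣S+yc = ∣m+n∣m⇒∣n (subst (p ∣_) (+-comm (S + y * (p C 2)) _) p∣S+yc+y²V₁) (∣m⇒∣m*n V₁ (∣m⇒∣m*n y p∣y))

  p∣X+1⇒p²∤S : p ∣ X + 1 → 2 ≤ p → ¬ p * p ∣ S
  p∣X+1⇒p²∤S p∣y 2≤p p²∣S = <⇒≱ (m<m*n p p 2≤p) (∣⇒≤ p²∣p)
    where
    p²∣y² : p * p ∣ y * y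
    p²∣y² = *-pres-∣ p∣y p∣y
    p²∣p : p * p ∣ p
    p²∣p = ∣m+n∣m⇒∣n
      (subst (p * p ∣_) (trans S+y*c+y²V₁≡p+y²V₂ (+-comm p _))
        (∣m∣n⇒∣m+n (∣m∣n⇒∣m+n p²∣S (*-pres-∣ p∣y p∣C2)) (∣m⇒∣m*n V₁ p²∣y²)))
      (∣m⇒∣m*n V₂ p²∣y²)

-- Primitive prime divisors

record PrimitivePrimeDivisor (d : ℕ) : Set where
  field
    q : ℕ
    q-prime : Prime q
    q∣F : q ∣ F d
    q∤F[proper] : ∀ {e} → e ∣ d → e ≢ d → ¬ q ∣ F e

proper-divisor-∣-cofactor : ∀ {e d} .{{_ : NonZero d}} → e ∣ d → e ≢ d →
  ∃ λ r → Prime r × Σ (r ∣ d) λ r∣d → e ∣ quotient r∣d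
proper-divisor-∣-cofactor {e} {d} (divides w d≡w*e) e≢d with w | d≡w*e
... | zero | refl = ⊥-elim (≢-nonZero⁻¹ d refl)
... | suc zero | d≡e+0 = ⊥-elim (e≢d (sym (trans d≡e+0 (+-identityʳ e))))
... | w@(suc (suc _)) | d≡w*e with ∃prime∣ {w} (s≤s (s≤s z≤n))
... | r , r-prime , divides w' w≡w'*r =
  r , r-prime , divides (w' * e) (begin
    d           ≡⟨ d≡w*e ⟩
    w * e       ≡⟨ cong (_* e) w≡w'*r ⟩
    w' * r * e  ≡⟨ solve 3 (λ a b c → a :* b :* c := a :* c :* b) refl w' r e ⟩
    w' * e * r  ∎) , n∣m*n w'
  where open ≡-Reasoning

module PrimitivePrimeDivisorConstruction
  {d K : ℕ} .{{_ : NonZero K}} (2∤d : ¬ 2 ∣ d)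
  (p*F[d/p]∣K : ∀ {p} → Prime p → (p∣d : p ∣ d) → p * F (quotient p∣d) ∣ K)
  (K<F[d] : K < F d)
  where

  private
    G = gcd (F d) K
    G∣F[d] : G ∣ F d
    G∣F[d] = gcd[m,n]∣m (F d) K
    R = quotient G∣F[d]
    F[d]≡R*G : F d ≡ R * G
    F[d]≡R*G = m∣n⇒n≡quotient*m G∣F[d]

    -- R = 1 would give F d = G ≤ K.
    2≤R : 2 ≤ R
    2≤R with R | F[d]≡R*G
    ... | zero | F[d]≡0 = ⊥-elim (0≢1+n (trans (sym F[d]≡0) (+-comm (2 ^ d) 1)))
    ... | suc zero | F[d]≡G+0 = ⊥-elim (<⇒≱ K<F[d] (begin
      F d     ≡⟨ trans F[d]≡G+0 (+-identityʳ G) ⟩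
      G       ≤⟨ ∣⇒≤ (gcd[m,n]∣n (F d) K) ⟩
      K       ∎))
      where open ≤-Reasoning
    ... | suc (suc _) | _ = s≤s (s≤s z≤n)

  q : ℕ
  q = proj₁ (∃prime∣ 2≤R)

  q-prime : Prime q
  q-prime = proj₁ (proj₂ (∃prime∣ 2≤R))

  q∣R : q ∣ R
  q∣R = proj₂ (proj₂ (∃prime∣ 2≤R))

  q∣F[d] : q ∣ F d
  q∣F[d] = ∣-trans q∣R (quotient-∣ G∣F[d])

  -- For d = c p: F d = F c · S with S = F (c p) / F c, and q ∣ S. If q also divided F c, the
  -- lifting-the-exponent facts force q = p and p² ∣ S, which is impossible.
  q∤F[d/p] : ∀ {p} → Prime p → (p∣d : p ∣ d) → ¬ q ∣ F (quotient p∣d)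
  q∤F[d/p] {p} p-prime p∣d q∣F[c] with odd⇒≡1+2* {p} (λ 2∣p → 2∤d (∣-trans 2∣p p∣d))
  ... | h , refl = p∣X+1⇒p²∤S p∣F[c] (prime⇒≥2 p-prime) (subst (λ r → r * r ∣ S) q≡p q²∣S)
    where
    open ≡-Reasoning
    c = quotient p∣d
    open OddPowerQuotient (2 ^ c) h hiding (p)
    d≡c*p : d ≡ c * p
    d≡c*p = m∣n⇒n≡quotient*m p∣d
    F[c]*S≡F[d] : F c * S ≡ F d
    F[c]*S≡F[d] = begin
      F c * S               ≡⟨ [X+1]*S≡X^p+1 ⟩
      (2 ^ c) ^ p + 1       ≡⟨ cong (_+ 1) (^-*-assoc 2 c p) ⟩
      F (c * p)             ≡⟨ cong F (sym d≡c*p) ⟩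
      F d                   ∎
    pF[c]∣K = p*F[d/p]∣K p-prime p∣d
    K' = quotient pF[c]∣K
    g' = gcd S (p * K')
    G≡F[c]*g' : G ≡ F c * g'
    G≡F[c]*g' = begin
      gcd (F d) K                         ≡⟨ cong₂ gcd (sym F[c]*S≡F[d]) (trans (m∣n⇒n≡quotient*m pF[c]∣K)
                                               (solve 3 (λ k p f → k :* (p :* f) := f :* (p :* k)) refl K' p (F c))) ⟩
      gcd (F c * S) (F c * (p * K'))      ≡⟨ c*gcd[m,n]≡gcd[cm,cn] (F c) S (p * K') ⟨
      F c * g'                            ∎
    S≡R*g' : S ≡ R * g'
    S≡R*g' = *-cancelˡ-≡ S (R * g') (F c) {{F≢0 c}} (begin
      F c * S          ≡⟨ F[c]*S≡F[d] ⟩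
      F d              ≡⟨ F[d]≡R*G ⟩
      R * G            ≡⟨ cong (R *_) G≡F[c]*g' ⟩
      R * (F c * g')   ≡⟨ solve 3 (λ r f g → r :* (f :* g) := f :* (r :* g)) refl R (F c) g' ⟩
      F c * (R * g')   ∎)
    q≡p : q ≡ p
    q≡p = prime∣prime⇒≡ p-prime q-prime
      (∣S∧∣X+1⇒∣p (subst (q ∣_) (sym S≡R*g') (∣m⇒∣m*n g' q∣R)) q∣F[c])
    p∣F[c] : p ∣ F c
    p∣F[c] = subst (_∣ F c) q≡p q∣F[c]
    q∣g' : q ∣ g'
    q∣g' = subst (_∣ g') (sym q≡p) (gcd-greatest (p∣X+1⇒p∣S p∣F[c]) (m∣m*n K'))
    q²∣S : q * q ∣ S
    q²∣S = subst (q * q ∣_) (sym S≡R*g') (*-pres-∣ q∣R q∣g')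

  primitivePrimeDivisor : PrimitivePrimeDivisor d
  primitivePrimeDivisor = record
    { q = q ; q-prime = q-prime ; q∣F = q∣F[d] ; q∤F[proper] = q∤F[proper] }
    where
    instance
      d≢0 : NonZero d
      d≢0 = >-nonZero (odd⇒≥1 2∤d)
    q∤F[proper] : ∀ {e} → e ∣ d → e ≢ d → ¬ q ∣ F e
    q∤F[proper] e∣d e≢d q∣F[e] with proper-divisor-∣-cofactor e∣d e≢d
    ... | r , r-prime , r∣d , e∣d/r =
      q∤F[d/p] r-prime r∣d (∣-trans q∣F[e] (F-mono-∣ e∣d/r (λ 2∣d/r → 2∤d (∣-trans 2∣d/r (quotient-∣ r∣d)))))

-- Abstract so that the type checker never unfolds ∃prime∣ on the symbolic number F d / gcd (F d) K.
abstract
  primitivePrimeDivisor : ∀ {d K} .{{_ : NonZero K}} → ¬ 2 ∣ d →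
    (∀ {p} → Prime p → (p∣d : p ∣ d) → p * F (quotient p∣d) ∣ K) →
    K < F d → PrimitivePrimeDivisor d
  primitivePrimeDivisor = PrimitivePrimeDivisorConstruction.primitivePrimeDivisor

open PrimitivePrimeDivisor

primitivePrimeDivisor-injective : ∀ {d d'} → ¬ 2 ∣ d → (P : PrimitivePrimeDivisor d) (P' : PrimitivePrimeDivisor d') →
  q P ≡ q P' → d ≡ d'
primitivePrimeDivisor-injective {d} {d'} 2∤d P P' q≡q' = trans (sym gcd≡d) gcd≡d'
  where
  q∣F[gcd] : q P ∣ F (gcd d d')
  q∣F[gcd] = prime∣F∧∣F⇒∣F[gcd] d d' (q-prime P) (odd⇒≥1 2∤d) (q∣F P) (subst (_∣ F d') (sym q≡q') (q∣F P'))
  gcd≡d : gcd d d' ≡ d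
  gcd≡d with gcd d d' ≟ d
  ... | yes gcd≡d = gcd≡d
  ... | no gcd≢d = ⊥-elim (q∤F[proper] P (gcd[m,n]∣m d d') gcd≢d q∣F[gcd])
  gcd≡d' : gcd d d' ≡ d'
  gcd≡d' with gcd d d' ≟ d'
  ... | yes gcd≡d' = gcd≡d'
  ... | no gcd≢d' = ⊥-elim (q∤F[proper] P' (gcd[m,n]∣n d d') gcd≢d' (subst (_∣ F (gcd d d')) q≡q' q∣F[gcd]))

-- Odd numbers given by a factorisation

Factorisation : Set
Factorisation = List (ℕ × ℕ)

value : Factorisation → ℕ
value [] = 1
value ((p , e) ∷ L) = p ^ e * value L

OddPrime : ℕ → Set
OddPrime p = Prime p × ¬ 2 ∣ p

OddPrimePowers : Factorisation → Set
OddPrimePowers = All (OddPrime ∘ proj₁)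

-- The pairs (p , m · value L / p) for the primes p of L with positive exponent; the accumulator m
-- collects the prime powers already passed.
cofactors : ℕ → Factorisation → List (ℕ × ℕ)
cofactors m [] = []
cofactors m ((p , zero) ∷ L) = cofactors m L
cofactors m ((p , suc e) ∷ L) = (p , m * p ^ e * value L) ∷ cofactors (m * p ^ suc e) L

K-factor : ℕ × ℕ → ℕ
K-factor (p , c) = p * F c

K : Factorisation → ℕ
K L = product (map K-factor (cofactors 1 L))

∈cofactors⇒*≡ : ∀ {p c} m L → (p , c) ∈ cofactors m L → c * p ≡ m * value L
∈cofactors⇒*≡ m ((_ , zero) ∷ L) pc∈ = trans (∈cofactors⇒*≡ m L pc∈) (cong (m *_) (sym (+-identityʳ (value L))))
∈cofactors⇒*≡ m ((p , suc e) ∷ L) (here refl) =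
  solve 4 (λ m p x v → m :* x :* v :* p := m :* (p :* x :* v)) refl m p (p ^ e) (value L)
∈cofactors⇒*≡ m ((p , suc e) ∷ L) (there pc∈) = trans (∈cofactors⇒*≡ (m * p ^ suc e) L pc∈) (*-assoc m _ _)

∈cofactors⇒∈ : ∀ {p c} m L → (p , c) ∈ cofactors m L → ∃ λ e → (p , e) ∈ L
∈cofactors⇒∈ m ((_ , zero) ∷ L) pc∈ with ∈cofactors⇒∈ m L pc∈
... | e , pe∈ = e , there pe∈
∈cofactors⇒∈ m ((p , suc e) ∷ L) (here refl) = suc e , here refl
∈cofactors⇒∈ m ((p , suc e) ∷ L) (there pc∈) with ∈cofactors⇒∈ (m * p ^ suc e) L pc∈
... | e' , pe∈ = e' , there pe∈

prime∣value⇒∈cofactors : ∀ {r} m L → OddPrimePowers L → Prime r → r ∣ value L → ∃ λ c → (r , c) ∈ cofactors m L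
prime∣value⇒∈cofactors m [] _ r-prime r∣1 with prime⇒≥2 r-prime | ∣1⇒≡1 r∣1
... | s≤s (s≤s _) | ()
prime∣value⇒∈cofactors m ((p , zero) ∷ L) (_ ∷ odd) r-prime r∣value =
  prime∣value⇒∈cofactors m L odd r-prime (subst (_ ∣_) (+-identityʳ (value L)) r∣value)
prime∣value⇒∈cofactors m ((p , suc e) ∷ L) ((p-prime , _) ∷ odd) r-prime r∣value
  with euclidsLemma (p ^ suc e) (value L) r-prime r∣value
... | inj₁ r∣p^e rewrite prime∣prime⇒≡ p-prime r-prime (prime∣^⇒∣ (suc e) r-prime r∣p^e) = _ , here refl
... | inj₂ r∣value with prime∣value⇒∈cofactors (m * p ^ suc e) L odd r-prime r∣value
...   | c , rc∈ = c , there rc∈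

value-odd : ∀ L → OddPrimePowers L → ¬ 2 ∣ value L
value-odd [] _ 2∣1 with ∣1⇒≡1 2∣1
... | ()
value-odd ((p , e) ∷ L) ((_ , 2∤p) ∷ odd) 2∣value with euclidsLemma (p ^ e) (value L) prime[2] 2∣value
... | inj₁ 2∣p^e = 2∤p (prime∣^⇒∣ e prime[2] 2∣p^e)
... | inj₂ 2∣value' = value-odd L odd 2∣value'

K≢0 : ∀ L → OddPrimePowers L → NonZero (K L)
K≢0 L odd = product≢0 (All.tabulate K-factor≢0)
  where
  K-factor≢0 : ∀ {t} → t ∈ map K-factor (cofactors 1 L) → NonZero t
  K-factor≢0 t∈ with ∈-map⁻ _ t∈
  ... | (p , c) , pc∈ , refl with ∈cofactors⇒∈ 1 L pc∈
  ...   | _ , pe∈ = m*n≢0 p (F c) {{prime⇒nonZero (proj₁ (All.lookup odd pe∈))}} {{F≢0 c}}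

p*F[value/p]∣K : ∀ L → OddPrimePowers L → ∀ {p} → Prime p → (p∣d : p ∣ value L) → p * F (quotient p∣d) ∣ K L
p*F[value/p]∣K L odd {p} p-prime p∣d with prime∣value⇒∈cofactors 1 L odd p-prime p∣d
... | c , pc∈ = subst (λ x → p * F x ∣ K L) c≡quotient (∈⇒∣product (∈-map⁺ K-factor pc∈))
  where
  c≡quotient : c ≡ quotient p∣d
  c≡quotient = *-cancelʳ-≡ c (quotient p∣d) p {{prime⇒nonZero p-prime}}
    (trans (trans (∈cofactors⇒*≡ 1 L pc∈) (*-identityˡ (value L))) (m∣n⇒n≡quotient*m p∣d))

primitivePrimeDivisor-value : ∀ L → OddPrimePowers L → K L < F (value L) → PrimitivePrimeDivisor (value L)
primitivePrimeDivisor-value L odd = primitivePrimeDivisor {{K≢0 L odd}} (value-odd L odd) (p*F[value/p]∣K L odd)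

weight : ℕ → Factorisation → ℕ
weight m L = sum (map (suc ∘ proj₂) (cofactors m L))

F≤2^[1+c] : ∀ c → F c ≤ 2 ^ suc c
F≤2^[1+c] c = subst (F c ≤_) (cong (2 ^ c +_) (sym (+-identityʳ (2 ^ c)))) (+-monoʳ-≤ (2 ^ c) (m^n>0 2 c))

prime⇒≤^ : ∀ {p} e → Prime p → p ≤ p ^ suc e
prime⇒≤^ {p} e p-prime = m≤m*n p (p ^ e) {{m^n≢0 p e {{prime⇒nonZero p-prime}}}}

product-cofactors≤value*2^weight : ∀ m L → OddPrimePowers L →
  product (map K-factor (cofactors m L)) ≤ value L * 2 ^ weight m L
product-cofactors≤value*2^weight m [] _ = s≤s z≤n
product-cofactors≤value*2^weight m ((p , zero) ∷ L) (_ ∷ odd) =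
  subst (λ v → product (map K-factor (cofactors m L)) ≤ v * 2 ^ weight m L) (sym (+-identityʳ (value L))) (product-cofactors≤value*2^weight m L odd)
product-cofactors≤value*2^weight m ((p , suc e) ∷ L) ((p-prime , _) ∷ odd) = begin
  p * F c * product (map K-factor (cofactors m' L))
    ≤⟨ *-mono-≤ (*-mono-≤ (prime⇒≤^ e p-prime) (F≤2^[1+c] c)) (product-cofactors≤value*2^weight m' L odd) ⟩
  p ^ suc e * 2 ^ suc c * (value L * 2 ^ w)
    ≡⟨ solve 4 (λ a b v s → a :* b :* (v :* s) := a :* v :* (b :* s)) refl (p ^ suc e) (2 ^ suc c) (value L) (2 ^ w) ⟩
  p ^ suc e * value L * (2 ^ suc c * 2 ^ w)
    ≡⟨ cong (p ^ suc e * value L *_) (^-distribˡ-+-* 2 (suc c) w) ⟨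
  p ^ suc e * value L * 2 ^ (suc c + w) ∎
  where
  open ≤-Reasoning
  c = m * p ^ e * value L
  m' = m * p ^ suc e
  w = weight m' L

data Sparse : ℕ → Factorisation → Set where
  [] : ∀ {u} → Sparse u []
  _∷_ : ∀ {u p e L} → 3 * u < p → Sparse (3 * u) L → Sparse u ((p , e) ∷ L)

Sparse⇒1≤value : ∀ {u L} → Sparse u L → 1 ≤ value L
Sparse⇒1≤value [] = s≤s z≤n
Sparse⇒1≤value {u} {(p , e) ∷ L} (3u<p ∷ sparse) = *-mono-≤ (m^n>0 p {{>-nonZero (≤-<-trans z≤n 3u<p)}} e) (Sparse⇒1≤value sparse)

-- The slack in 3u < p pays for the + 1 in each summand of the weight.
weight-Sparse : ∀ {u m L} → Sparse u L → 1 ≤ m → u * weight m L ≤ m * value L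
weight-Sparse {u} [] _ = ≤-trans (≤-reflexive (*-zeroʳ u)) z≤n
weight-Sparse {u} {m} {(p , zero) ∷ L} (_ ∷ sparse) 1≤m = begin
  u * weight m L       ≤⟨ *-monoˡ-≤ (weight m L) (m≤n*m u 3) ⟩
  3 * u * weight m L   ≤⟨ weight-Sparse sparse 1≤m ⟩
  m * value L          ≡⟨ cong (m *_) (+-identityʳ (value L)) ⟨
  m * (1 * value L)    ∎
  where open ≤-Reasoning
weight-Sparse {u} {m} {(p , suc e) ∷ L} (3u<p ∷ sparse) 1≤m = *-cancelˡ-≤ 3 (begin
  3 * (u * (suc c + w))        ≡⟨ solve 3 (λ u c w → con 3 :* (u :* (con 1 :+ c :+ w)) := con 3 :* u :* (con 1 :+ c) :+ con 3 :* u :* w) refl u c w ⟩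
  3 * u * suc c + 3 * u * w    ≤⟨ +-mono-≤ head tail ⟩
  2 * (c * p) + c * p          ≡⟨ solve 2 (λ c p → con 2 :* (c :* p) :+ c :* p := con 3 :* (c :* p)) refl c p ⟩
  3 * (c * p)                  ≡⟨ cong (3 *_) c*p≡m*value ⟩
  3 * (m * (p ^ suc e * value L)) ∎)
  where
  open ≤-Reasoning
  instance
    p≢0 : NonZero p
    p≢0 = >-nonZero (≤-<-trans z≤n 3u<p)
  c = m * p ^ e * value L
  m' = m * p ^ suc e
  w = weight m' L
  1≤c : 1 ≤ c
  1≤c = *-mono-≤ (*-mono-≤ 1≤m (m^n>0 p e)) (Sparse⇒1≤value sparse)
  c*p≡m*value : c * p ≡ m * (p ^ suc e * value L)
  c*p≡m*value = solve 4 (λ m p x v → m :* x :* v :* p := m :* (p :* x :* v)) refl m p (p ^ e) (value L)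
  head : 3 * u * suc c ≤ 2 * (c * p)
  head = begin
    3 * u * suc c       ≤⟨ *-monoʳ-≤ (3 * u) (+-monoˡ-≤ c 1≤c) ⟩
    3 * u * (c + c)     ≡⟨ solve 2 (λ a c → a :* (c :+ c) := con 2 :* (c :* a)) refl (3 * u) c ⟩
    2 * (c * (3 * u))   ≤⟨ *-monoʳ-≤ 2 (*-monoʳ-≤ c (<⇒≤ 3u<p)) ⟩
    2 * (c * p)         ∎
  tail : 3 * u * w ≤ c * p
  tail = begin
    3 * u * w                  ≤⟨ weight-Sparse sparse (*-mono-≤ 1≤m (m^n>0 p (suc e))) ⟩
    m * p ^ suc e * value L    ≡⟨ *-assoc m (p ^ suc e) (value L) ⟩
    m * (p ^ suc e * value L)  ≡⟨ c*p≡m*value ⟨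
    c * p                      ∎

2n+2≤2^n : ∀ n → 3 ≤ n → 2 * n + 2 ≤ 2 ^ n
2n+2≤2^n 1 (s≤s ())
2n+2≤2^n 2 (s≤s (s≤s ()))
2n+2≤2^n 3 _ = ≤-refl
2n+2≤2^n (suc n@(suc (suc (suc _)))) _ = begin
  2 * suc n + 2         ≡⟨ solve 1 (λ n → con 2 :* (con 1 :+ n) :+ con 2 := (con 2 :* n :+ con 2) :+ con 2) refl n ⟩
  (2 * n + 2) + 2       ≤⟨ +-mono-≤ (2n+2≤2^n n (s≤s (s≤s (s≤s z≤n)))) (^-monoʳ-≤ 2 {1} {n} (s≤s z≤n)) ⟩
  2 ^ n + 2 ^ n         ≡⟨ cong (2 ^ n +_) (+-identityʳ (2 ^ n)) ⟨
  2 ^ suc n             ∎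
  where open ≤-Reasoning

-- With u = d − s we have d ≤ 2u + 2 ≤ 2^u.
*2^≤2^ : ∀ d s → 9 ≤ d → 2 * s ≤ d + 2 → d * 2 ^ s ≤ 2 ^ d
*2^≤2^ d s 9≤d 2s≤d+2 = begin
  d * 2 ^ s        ≤⟨ *-monoˡ-≤ (2 ^ s) (≤-trans d≤2u+2 (2n+2≤2^n u 3≤u)) ⟩
  2 ^ u * 2 ^ s    ≡⟨ ^-distribˡ-+-* 2 u s ⟨
  2 ^ (u + s)      ≡⟨ cong (2 ^_) (trans (+-comm u s) s+u≡d) ⟩
  2 ^ d            ∎
  where
  open ≤-Reasoning
  s≤d : s ≤ d
  s≤d = *-cancelˡ-≤ 2 (≤-trans 2s≤d+2 (≤-trans (+-monoʳ-≤ d (≤-trans (s≤s (s≤s z≤n)) 9≤d)) (≤-reflexive (cong (d +_) (sym (+-identityʳ d))))))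
  u = d ∸ s
  s+u≡d : s + u ≡ d
  s+u≡d = m+[n∸m]≡n s≤d
  s≤u+2 : s ≤ u + 2
  s≤u+2 = +-cancelˡ-≤ s s (u + 2) (begin
    s + s          ≡⟨ cong (s +_) (+-identityʳ s) ⟨
    2 * s          ≤⟨ 2s≤d+2 ⟩
    d + 2          ≡⟨ cong (_+ 2) s+u≡d ⟨
    s + u + 2      ≡⟨ +-assoc s u 2 ⟩
    s + (u + 2)    ∎)
  d≤2u+2 : d ≤ 2 * u + 2
  d≤2u+2 = begin
    d              ≡⟨ s+u≡d ⟨
    s + u          ≤⟨ +-monoˡ-≤ u s≤u+2 ⟩
    u + 2 + u      ≡⟨ solve 1 (λ u → u :+ con 2 :+ u := con 2 :* u :+ con 2) refl u ⟩
    2 * u + 2      ∎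
  3≤u : 3 ≤ u
  3≤u = *-cancelˡ-≤ 2 (≤-trans (n≤1+n 6) (+-cancelʳ-≤ 2 7 (2 * u) (≤-trans 9≤d d≤2u+2)))

K<F[value] : ∀ a L → OddPrimePowers L → Sparse 6 L → K ((3 , 2 + a) ∷ L) < F (value ((3 , 2 + a) ∷ L))
K<F[value] a L odd sparse = begin-strict
  K L'               ≤⟨ product-cofactors≤value*2^weight 1 L' ((prime[3] , 2∤3) ∷ odd) ⟩
  d * 2 ^ w          ≤⟨ *2^≤2^ d w 9≤d 2w≤d+2 ⟩
  2 ^ d              <⟨ m<m+n (2 ^ d) (s≤s z≤n) ⟩
  F d                ∎
  where
  open ≤-Reasoning
  L' = (3 , 2 + a) ∷ L
  x = 3 ^ suc a
  V = value L
  d = value L'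
  w' = weight (1 * (3 * x)) L
  w = weight 1 L'
  9≤d : 9 ≤ d
  9≤d = *-mono-≤ {9} {3 * x} {1} {V} (*-monoʳ-≤ 3 (*-monoʳ-≤ 3 (^-monoʳ-≤ 3 {0} {a} z≤n))) (Sparse⇒1≤value sparse)
  6w'≤d : 6 * w' ≤ d
  6w'≤d = subst (λ m → 6 * w' ≤ m * V) (*-identityˡ (3 * x)) (weight-Sparse sparse (*-monoʳ-≤ 1 (m^n>0 3 (2 + a))))
  2w≤d+2 : 2 * w ≤ d + 2
  2w≤d+2 = *-cancelˡ-≤ 3 (begin
    3 * (2 * w)              ≡⟨ solve 3 (λ x v w' → con 3 :* (con 2 :* (con 1 :+ con 1 :* x :* v :+ w'))
                                               := con 6 :* w' :+ (con 2 :* (con 3 :* x :* v) :+ con 6)) refl x V w' ⟩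
    6 * w' + (2 * d + 6)     ≤⟨ +-monoˡ-≤ (2 * d + 6) 6w'≤d ⟩
    d + (2 * d + 6)          ≡⟨ solve 1 (λ d → d :+ (con 2 :* d :+ con 6) := con 3 :* (d :+ con 2)) refl d ⟩
    3 * (d + 2)              ∎)

-- Large primes dividing F (3^(i+2)) but not F (3^(i+1))

%≡%⇒∣ : ∀ a x r .{{_ : NonZero r}} → a % r ≡ (a + x) % r → r ∣ x
%≡%⇒∣ a x r a%r≡[a+x]%r = ∣m+n∣m⇒∣n (subst (r ∣_) split (n∣m*n ((a + x) / r))) (n∣m*n (a / r))
  where
  open ≡-Reasoning
  split : (a + x) / r * r ≡ a / r * r + x
  split = +-cancelˡ-≡ (a % r) _ _ (begin
    a % r + (a + x) / r * r       ≡⟨ cong (_+ (a + x) / r * r) a%r≡[a+x]%r ⟩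
    (a + x) % r + (a + x) / r * r ≡⟨ m≡m%n+[m/n]*n (a + x) r ⟨
    a + x                         ≡⟨ cong (_+ x) (m≡m%n+[m/n]*n a r) ⟩
    a % r + a / r * r + x         ≡⟨ +-assoc (a % r) _ x ⟩
    a % r + (a / r * r + x)       ∎)

odd-prime∤2 : ∀ {r} → Prime r → ¬ 2 ∣ r → ¬ r ∣ 2
odd-prime∤2 {r} r-prime 2∤r r∣2 = 2∤r (subst (_∣ r) (prime∣prime⇒≡ prime[2] r-prime r∣2) (∣-refl {r}))

odd-prime∤2^ : ∀ {r} t → Prime r → ¬ 2 ∣ r → ¬ r ∣ 2 ^ t
odd-prime∤2^ t r-prime 2∤r r∣2^t = odd-prime∤2 r-prime 2∤r (prime∣^⇒∣ t r-prime r∣2^t)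

odd-prime∣F⇒∤M : ∀ {r} a → Prime r → ¬ 2 ∣ r → r ∣ F a → ¬ r ∣ M a
odd-prime∣F⇒∤M {r} a r-prime 2∤r r∣F r∣M = odd-prime∤2 r-prime 2∤r (∣m+n∣m⇒∣n (subst (r ∣_) (F≡M+2 a) r∣F) r∣M)

-- Two of the r + 1 powers 2^0, …, 2^r agree modulo r.
∃r∣M : ∀ {r} → Prime r → ¬ 2 ∣ r → ∃ λ c → 1 ≤ c × c ≤ r × r ∣ M c
∃r∣M {r} r-prime 2∤r = fromCollision (pigeonhole (n<1+n r) residue)
  where
  instance
    r≢0 : NonZero r
    r≢0 = prime⇒nonZero r-prime
  residue : Fin (suc r) → Fin r
  residue t = fromℕ< (m%n<n (2 ^ toℕ t) r)
  fromCollision : (∃₂ λ i j → toℕ i < toℕ j × residue i ≡ residue j) → ∃ λ c → 1 ≤ c × c ≤ r × r ∣ M c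
  fromCollision (i , j , i<j , residue-i≡residue-j) =
    j′ ∸ i′ , m<n⇒0<n∸m i<j , ≤-trans (m∸n≤m j′ i′) (≤-pred (toℕ<n j)) , r∣M[c]
    where
    i′ = toℕ i
    j′ = toℕ j
    c = j′ ∸ i′
    2^j≡2^i+2^i*M[c] : 2 ^ j′ ≡ 2 ^ i′ + 2 ^ i′ * M c
    2^j≡2^i+2^i*M[c] = begin
      2 ^ j′              ≡⟨ cong (2 ^_) (m+[n∸m]≡n (<⇒≤ i<j)) ⟨
      2 ^ (i′ + c)        ≡⟨ ^-distribˡ-+-* 2 i′ c ⟩
      2 ^ i′ * 2 ^ c      ≡⟨ cong (2 ^ i′ *_) (2^≡1+M c) ⟩
      2 ^ i′ * suc (M c)  ≡⟨ *-suc (2 ^ i′) (M c) ⟩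
      2 ^ i′ + 2 ^ i′ * M c ∎
      where open ≡-Reasoning
    2^i%r≡2^j%r : 2 ^ i′ % r ≡ (2 ^ i′ + 2 ^ i′ * M c) % r
    2^i%r≡2^j%r = trans (sym (toℕ-fromℕ< _))
      (trans (cong toℕ residue-i≡residue-j) (trans (toℕ-fromℕ< _) (cong (_% r) 2^j≡2^i+2^i*M[c])))
    r∣M[c] : r ∣ M c
    r∣M[c] = [ (λ r∣2^i → ⊥-elim (odd-prime∤2^ i′ r-prime 2∤r r∣2^i)) , id ]′
      (euclidsLemma (2 ^ i′) (M c) r-prime (%≡%⇒∣ (2 ^ i′) (2 ^ i′ * M c) r 2^i%r≡2^j%r))

-- With T = 2 · 3^(ℓ+1) and c ≤ r as above, r ∣ M (gcd c T). A proper divisor of T divides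
-- 3^(ℓ+1) or 2 · 3^ℓ, and r divides neither M (3^(ℓ+1)) nor M (2 · 3^ℓ) = M (3^ℓ) F (3^ℓ).
-- Hence T = gcd c T ≤ r, and T ≠ r because T is even.
2*3^[1+ℓ]<prime : ∀ {r} ℓ → Prime r → ¬ 2 ∣ r → r ∣ F (3 ^ suc ℓ) → ¬ r ∣ F (3 ^ ℓ) → 2 * 3 ^ suc ℓ < r
2*3^[1+ℓ]<prime {r} ℓ r-prime 2∤r r∣F[3^[1+ℓ]] r∤F[3^ℓ] = T<r (∃r∣M r-prime 2∤r)
  where
  T = 2 * 3 ^ suc ℓ
  instance
    T≢0 : NonZero T
    T≢0 = m*n≢0 2 (3 ^ suc ℓ) {{_}} {{m^n≢0 3 (suc ℓ)}}
  r∤M[3^[1+ℓ]] : ¬ r ∣ M (3 ^ suc ℓ)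
  r∤M[3^[1+ℓ]] = odd-prime∣F⇒∤M (3 ^ suc ℓ) r-prime 2∤r r∣F[3^[1+ℓ]]
  r∣M[T] : r ∣ M T
  r∣M[T] = subst (r ∣_) (sym (M[2a]≡M*F (3 ^ suc ℓ))) (∣n⇒∣m*n (M (3 ^ suc ℓ)) r∣F[3^[1+ℓ]])
  r∤M[T/s] : ∀ {s} → Prime s → (s∣T : s ∣ T) → ¬ r ∣ M (quotient s∣T)
  r∤M[T/s] s-prime s∣T r∣M[T/s] with euclidsLemma 2 (3 ^ suc ℓ) s-prime s∣T
  ... | inj₁ s∣2 = r∤M[3^[1+ℓ]] (subst (λ e → r ∣ M e) (sym 3^[1+ℓ]≡T/2) r∣M[T/s])
    where
    3^[1+ℓ]≡T/2 : 3 ^ suc ℓ ≡ quotient s∣T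
    3^[1+ℓ]≡T/2 = *-cancelʳ-≡ _ _ 2 (trans (*-comm (3 ^ suc ℓ) 2)
      (subst (λ s → T ≡ quotient s∣T * s) (prime∣prime⇒≡ prime[2] s-prime s∣2) (m∣n⇒n≡quotient*m s∣T)))
  ... | inj₂ s∣3^[1+ℓ] with euclidsLemma (M (3 ^ ℓ)) (F (3 ^ ℓ)) r-prime
                              (subst (r ∣_) (M[2a]≡M*F (3 ^ ℓ)) (subst (λ e → r ∣ M e) (sym 2*3^ℓ≡T/3) r∣M[T/s]))
    where
    2*3^ℓ≡T/3 : 2 * 3 ^ ℓ ≡ quotient s∣T
    2*3^ℓ≡T/3 = *-cancelʳ-≡ _ _ 3 (trans (solve 1 (λ x → con 2 :* x :* con 3 := con 2 :* (con 3 :* x)) refl (3 ^ ℓ))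
      (subst (λ s → T ≡ quotient s∣T * s) (prime∣prime⇒≡ prime[3] s-prime (prime∣^⇒∣ (suc ℓ) s-prime s∣3^[1+ℓ]))
             (m∣n⇒n≡quotient*m s∣T)))
  ...   | inj₁ r∣M[3^ℓ] = r∤M[3^[1+ℓ]] (∣-trans r∣M[3^ℓ] (M-mono-∣ {3 ^ ℓ} {3 ^ suc ℓ} (divides 3 refl)))
  ...   | inj₂ r∣F[3^ℓ] = r∤F[3^ℓ] r∣F[3^ℓ]
  T<r : (∃ λ c → 1 ≤ c × c ≤ r × r ∣ M c) → T < r
  T<r (c , 1≤c , c≤r , r∣M[c]) with gcd c T ≟ T
  ... | yes g≡T = ≤∧≢⇒< (≤-trans (∣⇒≤ {{>-nonZero 1≤c}} (subst (_∣ c) g≡T (gcd[m,n]∣m c T))) c≤r)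
                       (λ T≡r → 2∤r (subst (2 ∣_) T≡r (m∣m*n (3 ^ suc ℓ))))
  ... | no g≢T with proper-divisor-∣-cofactor (gcd[m,n]∣n c T) g≢T
  ...   | s , s-prime , s∣T , g∣T/s =
    ⊥-elim (r∤M[T/s] s-prime s∣T (∣-trans (∣M∧∣M⇒∣M[gcd] c T r∣M[c] r∣M[T]) (M-mono-∣ g∣T/s)))

3∣F[odd] : ∀ {a} → ¬ 2 ∣ a → 3 ∣ F a
3∣F[odd] 2∤a with odd⇒≡1+2* 2∤a
... | s , refl = m+1∣m^[1+2s]+1 2 s

[X+1]*3<X^3+1 : ∀ X → 3 ≤ X → (X + 1) * 3 < X ^ 3 + 1
[X+1]*3<X^3+1 X 3≤X = begin-strict
  (X + 1) * 3                <⟨ m<m+n _ (s≤s z≤n) ⟩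
  (X + 1) * 3 + suc excess   ≡⟨ subst (λ x → (x + 1) * 3 + suc excess ≡ x ^ 3 + 1) (m+[n∸m]≡n 3≤X) expand ⟩
  X ^ 3 + 1                  ∎
  where
  open ≤-Reasoning
  t = X ∸ 3
  excess = 15 + 24 * t + 9 * (t * t) + t * t * t
  expand : (3 + t + 1) * 3 + suc excess ≡ (3 + t) ^ 3 + 1
  expand = solve 1 (λ t → (con 3 :+ t :+ con 1) :* con 3 :+ (con 1 :+ (con 15 :+ con 24 :* t :+ con 9 :* (t :* t) :+ t :* t :* t))
                       := (con 3 :+ t) :* ((con 3 :+ t) :* ((con 3 :+ t) :* con 1)) :+ con 1) refl t

record LargeNewPrime (i : ℕ) : Set where
  field
    ρ : ℕ
    ρ-prime : Prime ρ
    ρ-odd : ¬ 2 ∣ ρ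
    ρ∣F : ρ ∣ F (3 ^ suc (suc i))
    ρ∤F : ¬ ρ ∣ F (3 ^ suc i)
    ρ-large : 2 * 3 ^ suc (suc i) < ρ

-- With a = 3^(i+1), the quotient S = F (3a) / F a is divisible by 3 but not by 9 and exceeds 3,
-- so it has a prime factor r ≠ 3; such an r cannot divide F a, since then it would divide 3.
module LargeNewPrimeConstruction (i : ℕ) where

  private
    a = 3 ^ suc i
  open OddPowerQuotient (2 ^ a) 1

  private
    3∣F[a] : 3 ∣ F a
    3∣F[a] = 3∣F[odd] (2∤3^ (suc i))
    F[a]*S≡F[3a] : F a * S ≡ F (3 ^ suc (suc i))
    F[a]*S≡F[3a] = trans [X+1]*S≡X^p+1 (cong (_+ 1) (trans (^-*-assoc 2 a 3) (cong (2 ^_) (*-comm a 3))))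
    3<S : 3 < S
    3<S = *-cancelˡ-< (F a) 3 S (begin-strict
      F a * 3          <⟨ [X+1]*3<X^3+1 (2 ^ a) (≤-trans (s≤s (s≤s (s≤s z≤n))) (^-monoʳ-≤ 2 {3} {a} (^-monoʳ-≤ 3 {1} {suc i} (s≤s z≤n)))) ⟩
      (2 ^ a) ^ 3 + 1  ≡⟨ [X+1]*S≡X^p+1 ⟨
      F a * S          ∎)
      where open ≤-Reasoning

    fromPrimeFactor : ∀ {S' r} → S ≡ S' * 3 → Prime r → r ∣ S' → LargeNewPrime i
    fromPrimeFactor {S'} {r} S≡S'*3 r-prime r∣S' = record
      { ρ = r ; ρ-prime = r-prime ; ρ-odd = r-odd ; ρ∣F = r∣F[3a] ; ρ∤F = r∤F[a]
      ; ρ-large = 2*3^[1+ℓ]<prime (suc i) r-prime r-odd r∣F[3a] r∤F[a] }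
      where
      r∣S : r ∣ S
      r∣S = subst (r ∣_) (sym S≡S'*3) (∣m⇒∣m*n 3 r∣S')
      r∣F[3a] : r ∣ F (3 ^ suc (suc i))
      r∣F[3a] = subst (r ∣_) F[a]*S≡F[3a] (∣n⇒∣m*n (F a) r∣S)
      r-odd : ¬ 2 ∣ r
      r-odd 2∣r = 2∤F (m^n>0 3 (suc (suc i))) (∣-trans 2∣r r∣F[3a])
      r∤F[a] : ¬ r ∣ F a
      r∤F[a] r∣F[a] = p∣X+1⇒p²∤S 3∣F[a] (s≤s (s≤s z≤n))
        (subst (3 * 3 ∣_) (sym S≡S'*3) (*-monoˡ-∣ 3 (subst (_∣ S') r≡3 r∣S')))
        where
        r≡3 : r ≡ 3
        r≡3 = prime∣prime⇒≡ prime[3] r-prime (∣S∧∣X+1⇒∣p r∣S r∣F[a])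

  largeNewPrime : LargeNewPrime i
  largeNewPrime =
    let divides S' S≡S'*3 = p∣X+1⇒p∣S 3∣F[a]
        r , r-prime , r∣S' = ∃prime∣ (*-cancelʳ-< 3 1 S' (subst (3 <_) S≡S'*3 3<S))
    in fromPrimeFactor S≡S'*3 r-prime r∣S'

-- Abstract for the same reason as primitivePrimeDivisor.
abstract
  largeNewPrime : ∀ i → LargeNewPrime i
  largeNewPrime = LargeNewPrimeConstruction.largeNewPrime

-- Counting primitive prime divisors of F (N^k)

length-cartesianProductWith : ∀ {A B C : Set} (f : A → B → C) xs ys →
  length (cartesianProductWith f xs ys) ≡ length xs * length ys
length-cartesianProductWith f [] ys = refl
length-cartesianProductWith f (x ∷ xs) ys =
  trans (length-++ (map (f x) ys)) (cong₂ _+_ (length-map (f x) ys) (length-cartesianProductWith f xs ys))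

Unique-⊆⇒length≤ : ∀ {A : Set} {xs ys : List A} → Unique xs → (∀ {x} → x ∈ xs → x ∈ ys) → length xs ≤ length ys
Unique-⊆⇒length≤ {xs = []} _ _ = z≤n
Unique-⊆⇒length≤ {xs = x ∷ xs} {ys} (x∉xs ∷ unique) xs⊆ys with ∈-∃++ (xs⊆ys (here refl))
... | us , vs , refl = subst (suc (length xs) ≤_) (sym length-us++x∷vs) (s≤s (Unique-⊆⇒length≤ unique xs⊆us++vs))
  where
  length-us++x∷vs : length (us ++ x ∷ vs) ≡ suc (length (us ++ vs))
  length-us++x∷vs = trans (length-++ us) (trans (+-suc (length us) (length vs)) (cong suc (sym (length-++ us))))
  xs⊆us++vs : ∀ {y} → y ∈ xs → y ∈ us ++ vs
  xs⊆us++vs {y} y∈xs with ∈-++⁻ us (xs⊆ys (there y∈xs))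
  ... | inj₁ y∈us = ∈-++⁺ˡ y∈us
  ... | inj₂ (here refl) = ⊥-elim (All.lookup x∉xs y∈xs refl)
  ... | inj₂ (there y∈vs) = ∈-++⁺ʳ us y∈vs

Unique-map⁺ : ∀ {A B : Set} (f : A → B) {xs : List A} → Unique xs →
  (∀ {x y} → x ∈ xs → y ∈ xs → f x ≡ f y → x ≡ y) → Unique (map f xs)
Unique-map⁺ f [] _ = []
Unique-map⁺ f {x ∷ xs} (x∉xs ∷ unique) injective =
  map⁺ (All.tabulate f[x]∉) ∷ Unique-map⁺ f unique (λ x∈ y∈ → injective (there x∈) (there y∈))
  where
  f[x]∉ : ∀ {y} → y ∈ xs → ¬ f x ≡ f y
  f[x]∉ y∈xs fx≡fy = All.lookup x∉xs y∈xs (injective (here refl) (there y∈xs) fx≡fy)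

tuplesBelow : ℕ → ℕ → List (List ℕ)
tuplesBelow zero b = [] ∷ []
tuplesBelow (suc m) b = cartesianProductWith _∷_ (upTo b) (tuplesBelow m b)

length-tuplesBelow : ∀ m b → length (tuplesBelow m b) ≡ b ^ m
length-tuplesBelow zero b = refl
length-tuplesBelow (suc m) b =
  trans (length-cartesianProductWith _∷_ (upTo b) (tuplesBelow m b)) (cong₂ _*_ (length-upTo b) (length-tuplesBelow m b))

tuplesBelow-unique : ∀ m b → Unique (tuplesBelow m b)
tuplesBelow-unique zero b = [] ∷ []
tuplesBelow-unique (suc m) b = cartesianProductWith⁺ _∷_ ∷-injective (upTo⁺ b) (tuplesBelow-unique m b)
  where
  ∷-injective : ∀ {w x : ℕ} {ys zs} → w ∷ ys ≡ x ∷ zs → w ≡ x × ys ≡ zs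
  ∷-injective refl = refl , refl

∈-tuplesBelow⁻ : ∀ m b {v} → v ∈ tuplesBelow m b → length v ≡ m × All (_< b) v
∈-tuplesBelow⁻ zero b (here refl) = refl , []
∈-tuplesBelow⁻ (suc m) b v∈ with ∈-cartesianProductWith⁻ _∷_ (upTo b) (tuplesBelow m b) v∈
... | x , w , x∈ , w∈ , refl with ∈-tuplesBelow⁻ m b w∈
... | length-w , w<b = cong suc length-w , ∈-upTo⁻ x∈ ∷ w<b

ρ : ℕ → ℕ
ρ i = LargeNewPrime.ρ (largeNewPrime i)

module ρ (i : ℕ) = LargeNewPrime (largeNewPrime i)

3^[1+m]∣F[3^m] : ∀ m → 3 ^ suc m ∣ F (3 ^ m)
3^[1+m]∣F[3^m] zero = ∣-refl
3^[1+m]∣F[3^m] (suc m) = subst (3 ^ suc (suc m) ∣_) F[3^m]*S≡F[3^[1+m]]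
  (subst (_∣ F (3 ^ m) * S) (*-comm (3 ^ suc m) 3) (*-pres-∣ (3^[1+m]∣F[3^m] m) (p∣X+1⇒p∣S 3∣F[3^m])))
  where
  open OddPowerQuotient (2 ^ 3 ^ m) 1
  3∣F[3^m] : 3 ∣ F (3 ^ m)
  3∣F[3^m] = ∣-trans (divides (3 ^ m) (*-comm 3 (3 ^ m))) (3^[1+m]∣F[3^m] m)
  F[3^m]*S≡F[3^[1+m]] : F (3 ^ m) * S ≡ F (3 ^ suc m)
  F[3^m]*S≡F[3^[1+m]] = trans [X+1]*S≡X^p+1 (cong (_+ 1) (trans (^-*-assoc 2 (3 ^ m) 3) (cong (2 ^_) (*-comm (3 ^ m) 3))))

F[3^]-mono : ∀ {x y} → x ≤ y → F (3 ^ x) ∣ F (3 ^ y)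
F[3^]-mono {y = y} x≤y = F-mono-∣ (^-monoʳ-∣ 3 x≤y) (2∤3^ y)

ρ-injective : ∀ {i j} → i < j → ρ i ≢ ρ j
ρ-injective {i} {j} i<j ρi≡ρj = ρ.ρ∤F j (subst (_∣ F (3 ^ suc j)) ρi≡ρj (∣-trans (ρ.ρ∣F i) (F[3^]-mono (s≤s i<j))))

ρ≢3 : ∀ i → ρ i ≢ 3
ρ≢3 i ρ≡3 = <⇒≱ (ρ.ρ-large i) (≤-trans (≤-reflexive ρ≡3) (≤-trans (^-monoʳ-≤ 3 {1} {suc (suc i)} (s≤s z≤n)) (m≤n*m _ 2)))

ρPowers : ℕ → List ℕ → Factorisation
ρPowers i [] = []
ρPowers i (e ∷ es) = (ρ i , e) ∷ ρPowers (suc i) es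

candidate : ℕ → List ℕ → Factorisation
candidate a es = (3 , 2 + a) ∷ ρPowers 0 es

ρPowers-odd : ∀ i es → OddPrimePowers (ρPowers i es)
ρPowers-odd i [] = []
ρPowers-odd i (e ∷ es) = (ρ.ρ-prime i , ρ.ρ-odd i) ∷ ρPowers-odd (suc i) es

candidate-odd : ∀ a es → OddPrimePowers (candidate a es)
candidate-odd a es = (prime[3] , 2∤3) ∷ ρPowers-odd 0 es

ρPowers-sparse : ∀ i es → Sparse (2 * 3 ^ suc i) (ρPowers i es)
ρPowers-sparse i [] = []
ρPowers-sparse i (e ∷ es) = subst (_< ρ i) 2*3^[2+i]≡3*[2*3^[1+i]] (ρ.ρ-large i)
  ∷ subst (λ u → Sparse u (ρPowers (suc i) es)) 2*3^[2+i]≡3*[2*3^[1+i]] (ρPowers-sparse (suc i) es)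
  where
  2*3^[2+i]≡3*[2*3^[1+i]] : 2 * 3 ^ suc (suc i) ≡ 3 * (2 * 3 ^ suc i)
  2*3^[2+i]≡3*[2*3^[1+i]] = solve 1 (λ x → con 2 :* (con 3 :* x) := con 3 :* (con 2 :* x)) refl (3 ^ suc i)

prime∣value[ρPowers] : ∀ {r} i es → Prime r → r ∣ value (ρPowers i es) → ∃ λ j → i ≤ j × r ≡ ρ j
prime∣value[ρPowers] {r} i es r-prime r∣value
  with prime∣value⇒∈cofactors 1 (ρPowers i es) (ρPowers-odd i es) r-prime r∣value
... | _ , rc∈ = ∈ρPowers i es (proj₂ (∈cofactors⇒∈ 1 (ρPowers i es) rc∈))
  where
  ∈ρPowers : ∀ {e} i es → (r , e) ∈ ρPowers i es → ∃ λ j → i ≤ j × r ≡ ρ j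
  ∈ρPowers i (_ ∷ es) (here refl) = i , ≤-refl , refl
  ∈ρPowers i (_ ∷ es) (there re∈) with ∈ρPowers (suc i) es re∈
  ... | j , 1+i≤j , r≡ρj = j , ≤-trans (n≤1+n i) 1+i≤j , r≡ρj

ρ∤value[ρPowers] : ∀ i es → ¬ ρ i ∣ value (ρPowers (suc i) es)
ρ∤value[ρPowers] i es ρi∣value with prime∣value[ρPowers] (suc i) es (ρ.ρ-prime i) ρi∣value
... | j , i<j , ρi≡ρj = ρ-injective i<j ρi≡ρj

3∤value[ρPowers] : ∀ es → ¬ 3 ∣ value (ρPowers 0 es)
3∤value[ρPowers] es 3∣value with prime∣value[ρPowers] 0 es prime[3] 3∣value
... | j , _ , 3≡ρj = ρ≢3 j (sym 3≡ρj)

p^a*X≡p^b*Y⇒a≡b×X≡Y : ∀ {p} → Prime p → ∀ a b {X Y} → ¬ p ∣ X → ¬ p ∣ Y → p ^ a * X ≡ p ^ b * Y → a ≡ b × X ≡ Y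
p^a*X≡p^b*Y⇒a≡b×X≡Y p-prime zero zero {X} {Y} _ _ eq = refl , trans (sym (+-identityʳ X)) (trans eq (+-identityʳ Y))
p^a*X≡p^b*Y⇒a≡b×X≡Y {p} p-prime zero (suc b) {X} {Y} p∤X _ eq =
  ⊥-elim (p∤X (divides (p ^ b * Y) (trans (sym (+-identityʳ X)) (trans eq (solve 3 (λ p a y → p :* a :* y := a :* y :* p) refl p (p ^ b) Y)))))
p^a*X≡p^b*Y⇒a≡b×X≡Y {p} p-prime (suc a) zero {X} {Y} _ p∤Y eq =
  ⊥-elim (p∤Y (divides (p ^ a * X) (trans (sym (+-identityʳ Y)) (trans (sym eq) (solve 3 (λ p a x → p :* a :* x := a :* x :* p) refl p (p ^ a) X)))))
p^a*X≡p^b*Y⇒a≡b×X≡Y {p} p-prime (suc a) (suc b) {X} {Y} p∤X p∤Y eq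
  with p^a*X≡p^b*Y⇒a≡b×X≡Y p-prime a b p∤X p∤Y
         (*-cancelˡ-≡ _ _ p {{prime⇒nonZero p-prime}} (trans (sym (*-assoc p (p ^ a) X)) (trans eq (*-assoc p (p ^ b) Y))))
... | refl , X≡Y = refl , X≡Y

ρPowers-injective : ∀ i es fs → length es ≡ length fs → value (ρPowers i es) ≡ value (ρPowers i fs) → es ≡ fs
ρPowers-injective i [] [] _ _ = refl
ρPowers-injective i (e ∷ es) (f ∷ fs) |es|≡|fs| eq =
  let e≡f , eq' = p^a*X≡p^b*Y⇒a≡b×X≡Y (ρ.ρ-prime i) e f (ρ∤value[ρPowers] i es) (ρ∤value[ρPowers] i fs) eq
  in cong₂ _∷_ e≡f (ρPowers-injective (suc i) es fs (suc-injective |es|≡|fs|) eq')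

candidate-injective : ∀ a b es fs → length es ≡ length fs → value (candidate a es) ≡ value (candidate b fs) → (a , es) ≡ (b , fs)
candidate-injective a b es fs |es|≡|fs| eq =
  let 2+a≡2+b , eq' = p^a*X≡p^b*Y⇒a≡b×X≡Y prime[3] (2 + a) (2 + b) (3∤value[ρPowers] es) (3∤value[ρPowers] fs) eq
  in cong₂ _,_ (suc-injective (suc-injective 2+a≡2+b)) (ρPowers-injective 0 es fs |es|≡|fs| eq')

coprime-*-∣ : ∀ {a b N} → Coprime a b → a ∣ N → b ∣ N → a * b ∣ N
coprime-*-∣ {a} {b} coprime a∣N (divides t refl) = *-monoˡ-∣ b (coprime-divisor coprime (subst (a ∣_) (*-comm t b) a∣N))

prime∤⇒coprime[^] : ∀ {p m} e → Prime p → ¬ p ∣ m → Coprime (p ^ e) m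
prime∤⇒coprime[^] {p} e p-prime p∤m {zero} (0∣p^e , _) = ⊥-elim (≢-nonZero⁻¹ (p ^ e) {{m^n≢0 p e {{prime⇒nonZero p-prime}}}} (0∣⇒≡0 0∣p^e))
prime∤⇒coprime[^] e p-prime p∤m {1} _ = refl
prime∤⇒coprime[^] {p} {m} e p-prime p∤m {i@(suc (suc _))} (i∣p^e , i∣m) with ∃prime∣ {i} (s≤s (s≤s z≤n))
... | s , s-prime , s∣i = ⊥-elim (p∤m (subst (_∣ m) s≡p (∣-trans s∣i i∣m)))
  where
  s≡p : s ≡ p
  s≡p = prime∣prime⇒≡ p-prime s-prime (prime∣^⇒∣ e s-prime (∣-trans s∣i i∣p^e))

ρPowers-∣ : ∀ n k i es → All (_≤ k) es → i + length es ≤ n → value (ρPowers i es) ∣ F (3 ^ suc n) ^ k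
ρPowers-∣ n k i [] _ _ = 1∣ _
ρPowers-∣ n k i (e ∷ es) (e≤k ∷ es≤k) i+|e∷es|≤n =
  coprime-*-∣ (prime∤⇒coprime[^] e (ρ.ρ-prime i) (ρ∤value[ρPowers] i es))
    (∣-trans (^-monoʳ-∣ (ρ i) e≤k) (^-monoˡ-∣ k (∣-trans (ρ.ρ∣F i) (F[3^]-mono (s≤s 1+i≤n)))))
    (ρPowers-∣ n k (suc i) es es≤k 1+i+|es|≤n)
  where
  1+i+|es|≤n : suc i + length es ≤ n
  1+i+|es|≤n = subst (_≤ n) (+-suc i (length es)) i+|e∷es|≤n
  1+i≤n : suc i ≤ n
  1+i≤n = ≤-trans (m≤m+n (suc i) (length es)) 1+i+|es|≤n

candidate-∣ : ∀ n k a es → 2 + a ≤ suc (suc n) * k → length es ≤ n → All (_≤ k) es →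
  value (candidate a es) ∣ F (3 ^ suc n) ^ k
candidate-∣ n k a es 2+a≤[2+n]k |es|≤n es≤k = coprime-*-∣
  (prime∤⇒coprime[^] (2 + a) prime[3] (3∤value[ρPowers] es))
  (∣-trans (^-monoʳ-∣ 3 2+a≤[2+n]k) (subst (_∣ F (3 ^ suc n) ^ k) (^-*-assoc 3 (suc (suc n)) k) (^-monoˡ-∣ k (3^[1+m]∣F[3^m] (suc n)))))
  (ρPowers-∣ n k 0 es es≤k |es|≤n)

m<n∸1⇒2+m≤n : ∀ {m n} → m < n ∸ 1 → 2 + m ≤ n
m<n∸1⇒2+m≤n {n = suc n} m<n = s≤s m<n

primitiveOf : ∀ a es → PrimitivePrimeDivisor (value (candidate a es))
primitiveOf a es = primitivePrimeDivisor-value (candidate a es) (candidate-odd a es)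
  (K<F[value] a (ρPowers 0 es) (ρPowers-odd 0 es) (ρPowers-sparse 0 es))

ω-lower-bound : ∀ n k → ((2 + n) * k ∸ 1) * suc k ^ n ≤ ω (F (F (3 ^ suc n) ^ k))
ω-lower-bound n k = begin
  B * suc k ^ n                    ≡⟨ cong₂ _*_ (length-upTo B) (length-tuplesBelow n (suc k)) ⟨
  length (upTo B) * length (tuplesBelow n (suc k)) ≡⟨ length-cartesianProductWith _,_ (upTo B) (tuplesBelow n (suc k)) ⟨
  length candidates                ≡⟨ length-map q′ candidates ⟨
  length (map q′ candidates)       ≤⟨ Unique-⊆⇒length≤ (Unique-map⁺ q′ candidates-unique q′-injective) map-q′⊆primeDivisors ⟩
  ω A                              ∎
  where
  open ≤-Reasoning
  N = F (3 ^ suc n)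
  A = F (N ^ k)
  B = (2 + n) * k ∸ 1
  candidates : List (ℕ × List ℕ)
  candidates = cartesianProduct (upTo B) (tuplesBelow n (suc k))
  candidates-unique : Unique candidates
  candidates-unique = cartesianProduct⁺ (upTo⁺ B) (tuplesBelow-unique n (suc k))
  q′ : ℕ × List ℕ → ℕ
  q′ (a , es) = q (primitiveOf a es)
  candidate-∈⁻ : ∀ {a es} → (a , es) ∈ candidates → 2 + a ≤ (2 + n) * k × length es ≡ n × All (_≤ k) es
  candidate-∈⁻ v∈ =
    let a∈ , es∈ = ∈-cartesianProduct⁻ (upTo B) (tuplesBelow n (suc k)) v∈
        |es|≡n , es<1+k = ∈-tuplesBelow⁻ n (suc k) es∈
    in m<n∸1⇒2+m≤n (∈-upTo⁻ a∈) , |es|≡n , All.map ≤-pred es<1+k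
  q′-injective : ∀ {v w} → v ∈ candidates → w ∈ candidates → q′ v ≡ q′ w → v ≡ w
  q′-injective {a , es} {b , fs} v∈ w∈ q≡q = candidate-injective a b es fs
    (trans (proj₁ (proj₂ (candidate-∈⁻ v∈))) (sym (proj₁ (proj₂ (candidate-∈⁻ w∈)))))
    (primitivePrimeDivisor-injective (value-odd _ (candidate-odd a es)) (primitiveOf a es) (primitiveOf b fs) q≡q)
  2∤N^k : ¬ 2 ∣ N ^ k
  2∤N^k 2∣N^k = 2∤F (m^n>0 3 (suc n)) (prime∣^⇒∣ k prime[2] 2∣N^k)
  q′∈primeDivisors : ∀ {a es} → 2 + a ≤ (2 + n) * k → length es ≡ n → All (_≤ k) es → q′ (a , es) ∈ primeDivisors A
  q′∈primeDivisors {a} {es} 2+a≤ |es|≡n es≤k =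
    ∈-filter⁺ (λ p → prime? p ×-dec (p ∣? A)) (∈-upTo⁺ (s≤s (∣⇒≤ {{F≢0 (N ^ k)}} q∣A))) (q-prime P , q∣A)
    where
    P = primitiveOf a es
    q∣A : q′ (a , es) ∣ A
    q∣A = ∣-trans (q∣F P) (F-mono-∣ (candidate-∣ n k a es 2+a≤ (≤-reflexive |es|≡n) es≤k) 2∤N^k)
  map-q′⊆primeDivisors : ∀ {x} → x ∈ map q′ candidates → x ∈ primeDivisors A
  map-q′⊆primeDivisors x∈ = fromPreimage (∈-map⁻ q′ x∈)
    where
    fromPreimage : ∀ {x} → (∃ λ v → v ∈ candidates × x ≡ q′ v) → x ∈ primeDivisors A
    fromPreimage ((a , es) , v∈ , refl) =
      let 2+a≤ , |es|≡n , es≤k = candidate-∈⁻ v∈ in q′∈primeDivisors 2+a≤ |es|≡n es≤k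

2+k≤[2+n]*[1+k]∸1 : ∀ n k → 1 ≤ n + k → 2 + k ≤ (2 + n) * suc k ∸ 1
2+k≤[2+n]*[1+k]∸1 n k 1≤n+k = begin
  2 + k                          ≡⟨ cong suc (+-comm 1 k) ⟩
  suc (k + 1)                    ≤⟨ s≤s (+-monoʳ-≤ k (≤-trans 1≤n+k (≤-trans (≤-reflexive (+-comm n k)) (m≤m+n (k + n) (n * k))))) ⟩
  suc (k + (k + n + n * k))      ≡⟨ cong (_∸ 1) expand ⟨
  (2 + n) * suc k ∸ 1            ∎
  where
  open ≤-Reasoning
  expand : (2 + n) * suc k ≡ suc (suc (k + (k + n + n * k)))
  expand = solve 2 (λ n k → (con 2 :+ n) :* (con 1 :+ k) := con 2 :+ (k :+ (k :+ n :+ n :* k))) refl n k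

[2+k]^[1+n]∸1≤[[2+n]*[1+k]∸1]*[2+k]^n : ∀ n k → suc (suc k) ^ suc n ∸ 1 ≤ ((2 + n) * suc k ∸ 1) * suc (suc k) ^ n
[2+k]^[1+n]∸1≤[[2+n]*[1+k]∸1]*[2+k]^n zero zero = ≤-refl
[2+k]^[1+n]∸1≤[[2+n]*[1+k]∸1]*[2+k]^n (suc n) k = ≤-trans (m∸n≤m _ 1) (*-monoˡ-≤ _ (2+k≤[2+n]*[1+k]∸1 (suc n) k (s≤s z≤n)))
[2+k]^[1+n]∸1≤[[2+n]*[1+k]∸1]*[2+k]^n zero (suc k) = ≤-trans (m∸n≤m _ 1) (*-monoˡ-≤ _ (2+k≤[2+n]*[1+k]∸1 zero (suc k) (s≤s z≤n)))

corollary2 : (n k : ℕ) → 1 ≤ n → 1 ≤ k →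
    ((suc k ^ n) ∸ 1 ≤ ω (2 ^ ((2 ^ (3 ^ n) + 1) ^ k) + 1)) × (k ^ n ≤ (suc k ^ n) ∸ 1)
corollary2 (suc n) (suc k) _ _ =
  ≤-trans ([2+k]^[1+n]∸1≤[[2+n]*[1+k]∸1]*[2+k]^n n k) (ω-lower-bound n (suc k)) ,
  ∸-monoˡ-≤ 1 (^-monoˡ-< (suc n) (n<1+n (suc k)))
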